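{- Let $D$ be a digraph and $F=(f_1,\dots,f_s)$ a sequence of functions $f_i:V(D)\to\mathbb{N}^2$ such that $(D,F)$ is a hard pair. Then $D$ is not $F$-dicolourable.
   Context: Digraphs are finite, without loops or parallel arcs (digons allowed). For $f:V(D)\to\mathbb{N}^2$ write $f=(f^-,f^+)$; $\mathbb{N}^2$ is added componentwise. A digraph $D$ is strictly-$f$-bidegenerate if every non-empty subdigraph $H$ of $D$ contains a vertex $v$ with $d_H^-(v)<f^-(v)$ or $d_H^+(v)<f^+(v)$. An $F$-dicolouring of $D$ is a map $\alpha:V(D)\to[s]$ such that for every $i$ the subdigraph induced by $\alpha^{ -1}(i)$ is strictly-$f_i$-bidegenerate. $D$ is biconnected if it has at least two vertices and its underlying graph stays connected after deleting any vertex. A pair $(D,F)$ is hard if one of: (i) $D$ is biconnected and for some $i$, for every $v$, $f_i(v)=(d^-(v),d^+(v))$ and $f_k(v)=(0,0)$ for $k\ne i$; (ii) $D$ is a bidirected odd cycle and all $f_k$ are constantly $(0,0)$ except exactly two which are constantly $(1,1)$; (iii) $D$ is a bidirected complete graph, all $f_k$ are constant and symmetric ($f_k^-=f_k^+$), and $\sum_k f_k^+(v)=|V(D)|-1$; (iv) $(D,F)$ is obtained from two hard pairs $(D^1,F^1)$, $(D^2,F^2)$ on disjoint vertex sets by identifying $x_1\in V(D^1)$, $x_2\in V(D^2)$ into a new vertex $x$, with $f_k=f^1_k$ on $V(D^1)\setminus\{x_1\}$, $f_k=f^2_k$ on $V(D^2)\setminus\{x_2\}$, and $f_k(x)=f^1_k(x_1)+f^2_k(x_2)$.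 -}

module Defs where

open import Data.Nat using (ℕ; zero; suc; _+_; _*_; _<_; _≤_)
open import Data.Fin using (Fin; toℕ)
open import Data.Bool using (Bool; true; false)
open import Data.Product using (Σ; ∃; ∃-syntax; _×_; _,_; proj₁; proj₂)
open import Data.Sum using (_⊎_)
open import Relation.Binary.PropositionalEquality using (_≡_; _≢_)
open import Relation.Nullary using (¬_)
open import Data.Unit using (⊤)
open import Function.Bundles using (_⤖_; Bijection)
open import Function.Definitions using (Injective)

-- Digraph on vertex set Fin n: arc u v = true iff there is an arc u → v.
-- No loops; no parallel arcs (automatic with a Boolean relation); digons allowed.
record Digraph (n : ℕ) : Set where
  field
    arc      : Fin n → Fin n → Bool
    loopless : ∀ v → arc v v ≡ false
open Digraph public

count : ∀ {n} → (Fin n → Bool) → ℕ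
count {zero}  p = 0
count {suc n} p with p Fin.zero
... | true  = suc (count (λ i → p (Fin.suc i)))
... | false = count (λ i → p (Fin.suc i))

_+²_ : ℕ × ℕ → ℕ × ℕ → ℕ × ℕ
(a , b) +² (c , d) = (a + c , b + d)

indeg outdeg : ∀ {n} → Digraph n → Fin n → ℕ
indeg  D v = count (λ u → arc D u v)
outdeg D v = count (λ u → arc D v u)

record Sub {n : ℕ} (D : Digraph n) : Set where
  field
    vs  : Fin n → Bool
    as  : Fin n → Fin n → Bool
    as⊆ : ∀ u v → as u v ≡ true → (arc D u v ≡ true × vs u ≡ true × vs v ≡ true)
open Sub public

subIndeg subOutdeg : ∀ {n} {D : Digraph n} → Sub D → Fin n → ℕ
subIndeg  H v = count (λ u → as H u v)
subOutdeg H v = count (λ u → as H v u)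

-- D[X] is strictly-f-bidegenerate: every non-empty subdigraph H of D[X]
-- (= subdigraph of D with all vertices in X) has a vertex v with
-- d_H^-(v) < f^-(v) or d_H^+(v) < f^+(v).
StrictlyBidegenerateOn : ∀ {n} → Digraph n → (Fin n → Set) → (Fin n → ℕ × ℕ) → Set
StrictlyBidegenerateOn D X f =
  (H : Sub D) → (∀ v → vs H v ≡ true → X v) → (∃[ v ] vs H v ≡ true) →
  ∃[ v ] (vs H v ≡ true × (subIndeg H v < proj₁ (f v) ⊎ subOutdeg H v < proj₂ (f v)))

IsFDicolouring : ∀ {n s} → Digraph n → (Fin s → Fin n → ℕ × ℕ) → (Fin n → Fin s) → Set
IsFDicolouring D F α = ∀ i → StrictlyBidegenerateOn D (λ v → α v ≡ i) (F i)

FDicolourable : ∀ {n s} → Digraph n → (Fin s → Fin n → ℕ × ℕ) → Set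
FDicolourable {n} {s} D F = ∃[ α ] IsFDicolouring {n} {s} D F α

Adj : ∀ {n} → Digraph n → Fin n → Fin n → Set
Adj D u v = arc D u v ≡ true ⊎ arc D v u ≡ true

data Reach {n : ℕ} (D : Digraph n) (X : Fin n → Set) : Fin n → Fin n → Set where
  here : ∀ {u} → X u → Reach D X u u
  step : ∀ {u v w} → X u → Adj D u v → Reach D X v w → Reach D X u w

Connected : ∀ {n} → Digraph n → Set
Connected D = ∀ u v → Reach D (λ _ → ⊤) u v

Biconnected : ∀ {n} → Digraph n → Set
Biconnected {n} D =
  2 ≤ n × Connected D ×
  (∀ w u v → u ≢ w → v ≢ w → Reach D (λ z → z ≢ w) u v)

CycNext : ∀ {n} → Fin n → Fin n → Set
CycNext {n} i j = suc (toℕ i) ≡ toℕ j ⊎ (suc (toℕ i) ≡ n × toℕ j ≡ 0)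

BidirectedOddCycle : ∀ {n} → Digraph n → Set
BidirectedOddCycle {n} D =
  (∃[ k ] n ≡ 3 + 2 * k) ×
  Σ (Fin n ⤖ Fin n) (λ σ → ∀ i j →
     (arc D (Bijection.to σ i) (Bijection.to σ j) ≡ true → (CycNext i j ⊎ CycNext j i)) ×
     ((CycNext i j ⊎ CycNext j i) → arc D (Bijection.to σ i) (Bijection.to σ j) ≡ true))

BidirectedComplete : ∀ {n} → Digraph n → Set
BidirectedComplete {n} D = ∀ (u v : Fin n) → (arc D u v ≡ true → u ≢ v) × (u ≢ v → arc D u v ≡ true)

sumFin : ∀ {s} → (Fin s → ℕ) → ℕ
sumFin {zero}  c = 0
sumFin {suc s} c = c Fin.zero + sumFin (λ i → c (Fin.suc i))

data Hard : ∀ {n s} → Digraph n → (Fin s → Fin n → ℕ × ℕ) → Set where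
  hard-i : ∀ {n s} (D : Digraph n) (F : Fin s → Fin n → ℕ × ℕ) →
    Biconnected D → (i : Fin s) →
    (∀ v → F i v ≡ (indeg D v , outdeg D v)) →
    (∀ k v → k ≢ i → F k v ≡ (0 , 0)) →
    Hard D F
  hard-ii : ∀ {n s} (D : Digraph n) (F : Fin s → Fin n → ℕ × ℕ) →
    BidirectedOddCycle D → (i j : Fin s) → i ≢ j →
    (∀ v → F i v ≡ (1 , 1)) → (∀ v → F j v ≡ (1 , 1)) →
    (∀ k v → k ≢ i → k ≢ j → F k v ≡ (0 , 0)) →
    Hard D F
  hard-iii : ∀ {n s} (D : Digraph n) (F : Fin s → Fin n → ℕ × ℕ) →
    BidirectedComplete D → (c : Fin s → ℕ) →
    (∀ k v → F k v ≡ (c k , c k)) →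
    suc (sumFin c) ≡ n →
    Hard D F
  -- (iv) D is (isomorphic to) the digraph obtained from D¹, D² by identifying
  -- x₁ and x₂ into x; ι₁, ι₂ are the embeddings of V(D¹), V(D²) into V(D).
  hard-iv : ∀ {n n₁ n₂ s} (D : Digraph n) (F : Fin s → Fin n → ℕ × ℕ)
    (D₁ : Digraph n₁) (F₁ : Fin s → Fin n₁ → ℕ × ℕ)
    (D₂ : Digraph n₂) (F₂ : Fin s → Fin n₂ → ℕ × ℕ) →
    Hard D₁ F₁ → Hard D₂ F₂ →
    (ι₁ : Fin n₁ → Fin n) (ι₂ : Fin n₂ → Fin n) (x₁ : Fin n₁) (x₂ : Fin n₂) →
    Injective _≡_ _≡_ ι₁ → Injective _≡_ _≡_ ι₂ →
    ι₁ x₁ ≡ ι₂ x₂ →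
    (∀ a b → ι₁ a ≡ ι₂ b → a ≡ x₁) →
    (∀ v → (∃[ a ] ι₁ a ≡ v) ⊎ (∃[ b ] ι₂ b ≡ v)) →
    (∀ a b → arc D (ι₁ a) (ι₁ b) ≡ arc D₁ a b) →
    (∀ a b → arc D (ι₂ a) (ι₂ b) ≡ arc D₂ a b) →
    (∀ a b → a ≢ x₁ → b ≢ x₂ → arc D (ι₁ a) (ι₂ b) ≡ false × arc D (ι₂ b) (ι₁ a) ≡ false) →
    (∀ k a → a ≢ x₁ → F k (ι₁ a) ≡ F₁ k a) →
    (∀ k b → b ≢ x₂ → F k (ι₂ b) ≡ F₂ k b) →
    (∀ k → F k (ι₁ x₁) ≡ F₁ k x₁ +² F₂ k x₂) →
    Hard D F

module Submission where

-- For every colouring α of a hard pair we exhibit an obstruction: a non-empty set X of vertices of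
-- one colour k such that every v ∈ X has in- and out-degree at least f_k(v) inside D[X], which
-- refutes strict f_k-bidegeneracy of that colour class.  A vertex whose colour has demand (0,0) is
-- an obstruction by itself; otherwise in case (i) all of D has colour i, and in case (ii) α is a
-- 2-colouring of an odd cycle, so some arc joins two vertices of the same colour and that digon is
-- an obstruction.  In case (iii) a weighted pigeonhole principle gives a colour class with more
-- than c_k vertices, each of which has at least c_k neighbours in the class.  In case (iv) an
-- obstruction for one part that avoids the identified vertex x transfers to D; otherwise both
-- parts have obstructions through x of the colour of x, and their union is one for D, because the
-- demands at x add up while the neighbourhoods of x in the two parts are disjoint.

open import Defs
open import Data.Nat using (ℕ; zero; suc; _+_; _*_; _%_; _≤_; _<_; z≤n; s≤s; z<s; _<?_; NonZero)
open import Data.Nat.Properties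
  using (≤-refl; ≤-reflexive; ≤-trans; ≤-pred; +-suc; +-mono-≤; *-comm; <⇒≱; ≮⇒≥;
         m<n⇒m<1+n; m≤n⇒m<n∨m≡n; anyUpTo?; +-commutativeSemigroup; module ≤-Reasoning)
open import Data.Nat.DivMod using (_mod_; m<n⇒m%n≡m; n%n≡0)
open import Algebra.Properties.CommutativeSemigroup +-commutativeSemigroup using (interchange)
open import Data.Fin using (Fin; zero; suc; toℕ)
open import Data.Fin.Properties using (_≟_; any?; suc-injective; toℕ-injective; toℕ-fromℕ<)
open import Data.Bool using (Bool; true; false; _∧_; _∨_; not; if_then_else_)
import Data.Bool.Properties as Bool
open import Data.Product using (∃-syntax; _×_; _,_; proj₁; proj₂)
open import Data.Product.Relation.Binary.Pointwise.NonDependent using (Pointwise)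
open import Data.Sum using (_⊎_; inj₁; inj₂)
open import Data.Empty using (⊥; ⊥-elim)
open import Function using (_∘_)
open import Function.Bundles using (Bijection)
open import Function.Definitions using (Injective)
open import Relation.Binary.PropositionalEquality
open import Relation.Binary.Definitions using (DecidableEquality)
open import Relation.Nullary using (¬_; yes; no; does; ¬?)
open import Relation.Nullary.Decidable using (dec-true; dec-false; decidable-stable; _×-dec_)

_==_ : ∀ {n} → Fin n → Fin n → Bool
u == v = does (u ≟ v)

==-refl : ∀ {n} (v : Fin n) → v == v ≡ true
==-refl v = dec-true (v ≟ v) refl

==⇒≡ : ∀ {n} {u v : Fin n} → u == v ≡ true → u ≡ v
==⇒≡ {u = u} {v} eq with u ≟ v
... | yes u≡v = u≡v

≢⇒not== : ∀ {n} {u v : Fin n} → u ≢ v → not (u == v) ≡ true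
≢⇒not== {u = u} {v} u≢v = cong not (dec-false (u ≟ v) u≢v)

not==⇒≢ : ∀ {n} {u v : Fin n} → not (u == v) ≡ true → u ≢ v
not==⇒≢ {v = v} eq refl with () ← trans (sym (cong not (==-refl v))) eq

∧-intro : ∀ {a b} → a ≡ true → b ≡ true → a ∧ b ≡ true
∧-intro refl refl = refl

∧-elim : ∀ a {b} → a ∧ b ≡ true → a ≡ true × b ≡ true
∧-elim true eq = refl , eq

∨-elim : ∀ a {b} → a ∨ b ≡ true → a ≡ true ⊎ b ≡ true
∨-elim true  _  = inj₁ refl
∨-elim false eq = inj₂ eq

∨-introʳ : ∀ a {b} → b ≡ true → a ∨ b ≡ true
∨-introʳ a refl = Bool.∨-zeroʳ a

count-head : ∀ {n} (p : Fin (suc n) → Bool) → count p ≡ (if p zero then 1 else 0) + count (p ∘ suc)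
count-head p with p zero
... | true  = refl
... | false = refl

count-cong : ∀ {n} {p q : Fin n → Bool} → (∀ u → p u ≡ q u) → count p ≡ count q
count-cong {zero}  _ = refl
count-cong {suc n} {p} {q} p≗q rewrite p≗q zero with q zero
... | true  = cong suc (count-cong (p≗q ∘ suc))
... | false = count-cong (p≗q ∘ suc)

count-remove : ∀ {n} {p : Fin n → Bool} v → p v ≡ true →
  count p ≡ suc (count (λ u → not (u == v) ∧ p u))
count-remove {suc n} {p} zero pv rewrite pv = refl
count-remove {suc n} {p} (suc v) pv with p zero
... | true  = cong suc (count-remove v pv)
... | false = count-remove v pv

count-pos : ∀ {n} {p : Fin n → Bool} v → p v ≡ true → 0 < count p
count-pos {p = p} v pv = subst (0 <_) (sym (count-remove {p = p} v pv)) z<s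

count-witness : ∀ {n} (p : Fin n → Bool) → 0 < count p → ∃[ v ] p v ≡ true
count-witness {suc n} p pos with p zero in pz
... | true  = zero , pz
... | false with count-witness (p ∘ suc) pos
...   | v , pv = suc v , pv

count-inj : ∀ {m n} {ι : Fin m → Fin n} → Injective _≡_ _≡_ ι →
  {p : Fin m → Bool} {q : Fin n → Bool} → (∀ a → p a ≡ true → q (ι a) ≡ true) → count p ≤ count q
count-inj {zero} _ _ = z≤n
count-inj {suc m} {ι = ι} ι-injective {p} {q} p⇒q with p zero in pz
... | false = count-inj (suc-injective ∘ ι-injective) (p⇒q ∘ suc)
... | true  = begin
  suc (count (p ∘ suc))                       ≤⟨ s≤s (count-inj (suc-injective ∘ ι-injective) fresh) ⟩
  suc (count (λ u → not (u == ι zero) ∧ q u)) ≡⟨ count-remove (ι zero) (p⇒q zero pz) ⟨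
  count q                                     ∎
  where
  open ≤-Reasoning
  suc≢zero : ∀ {a : Fin m} → Fin.suc a ≢ zero
  suc≢zero ()
  fresh : ∀ a → p (suc a) ≡ true → not (ι (suc a) == ι zero) ∧ q (ι (suc a)) ≡ true
  fresh a pa = ∧-intro (≢⇒not== (suc≢zero ∘ ι-injective)) (p⇒q (suc a) pa)

count-mono : ∀ {n} {p q : Fin n → Bool} → (∀ u → p u ≡ true → q u ≡ true) → count p ≤ count q
count-mono = count-inj (λ eq → eq)

count-∨ : ∀ {n} {p q : Fin n → Bool} → (∀ u → p u ≡ true → q u ≡ true → ⊥) →
  count p + count q ≤ count (λ u → p u ∨ q u)
count-∨ {zero} _ = z≤n
count-∨ {suc n} {p} {q} disjoint with p zero in pz | q zero in qz
... | true  | true  = ⊥-elim (disjoint zero pz qz)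
... | true  | false = s≤s (count-∨ (disjoint ∘ suc))
... | false | true  = ≤-trans (≤-reflexive (+-suc _ _)) (s≤s (count-∨ (disjoint ∘ suc)))
... | false | false = count-∨ (disjoint ∘ suc)

sumFin-cong : ∀ {s} {f g : Fin s → ℕ} → (∀ k → f k ≡ g k) → sumFin f ≡ sumFin g
sumFin-cong {zero}  _   = refl
sumFin-cong {suc s} f≗g = cong₂ _+_ (f≗g zero) (sumFin-cong (f≗g ∘ suc))

sumFin-+ : ∀ {s} (f g : Fin s → ℕ) → sumFin (λ k → f k + g k) ≡ sumFin f + sumFin g
sumFin-+ {zero}  f g = refl
sumFin-+ {suc s} f g =
  trans (cong (f zero + g zero +_) (sumFin-+ (f ∘ suc) (g ∘ suc)))
        (interchange (f zero) (g zero) (sumFin (f ∘ suc)) (sumFin (g ∘ suc)))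

sumFin-mono : ∀ {s} {f g : Fin s → ℕ} → (∀ k → f k ≤ g k) → sumFin f ≤ sumFin g
sumFin-mono {zero}  _   = z≤n
sumFin-mono {suc s} f≤g = +-mono-≤ (f≤g zero) (sumFin-mono (f≤g ∘ suc))

sumFin-zero : ∀ s → sumFin {s} (λ _ → 0) ≡ 0
sumFin-zero zero    = refl
sumFin-zero (suc s) = sumFin-zero s

sumFin-indicator : ∀ {s} (c : Fin s) → sumFin (λ k → if c == k then 1 else 0) ≡ 1
sumFin-indicator {suc s} zero = cong suc (sumFin-zero s)
sumFin-indicator (suc c)      = sumFin-indicator c

sumFin-classSizes : ∀ {n s} (α : Fin n → Fin s) → sumFin (λ k → count (λ v → α v == k)) ≡ n
sumFin-classSizes {zero}  {s} α = sumFin-zero s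
sumFin-classSizes {suc n}     α = begin
  sumFin (λ k → count (λ v → α v == k))
    ≡⟨ sumFin-cong (λ k → count-head (λ v → α v == k)) ⟩
  sumFin (λ k → (if α zero == k then 1 else 0) + count (λ v → α (suc v) == k))
    ≡⟨ sumFin-+ (λ k → if α zero == k then 1 else 0) (λ k → count (λ v → α (suc v) == k)) ⟩
  sumFin (λ k → if α zero == k then 1 else 0) + sumFin (λ k → count (λ v → α (suc v) == k))
    ≡⟨ cong₂ _+_ (sumFin-indicator (α zero)) (sumFin-classSizes (α ∘ suc)) ⟩
  suc n ∎
  where open ≡-Reasoning

pigeonhole-weighted : ∀ {n s} (α : Fin n → Fin s) (c : Fin s → ℕ) → sumFin c < n →
  ∃[ k ] c k < count (λ v → α v == k)
pigeonhole-weighted {n} α c Σc<n with any? (λ k → c k <? count (λ v → α v == k))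
... | yes overfull = overfull
... | no  none     = ⊥-elim (<⇒≱ Σc<n (begin
  n                                     ≡⟨ sumFin-classSizes α ⟨
  sumFin (λ k → count (λ v → α v == k)) ≤⟨ sumFin-mono (λ k → ≮⇒≥ (none ∘ (k ,_))) ⟩
  sumFin c                              ∎))
  where open ≤-Reasoning

infix 4 _≤²_

_≤²_ : ℕ × ℕ → ℕ × ℕ → Set
_≤²_ = Pointwise _≤_ _≤_

≤²-trans : ∀ {p q r} → p ≤² q → q ≤² r → p ≤² r
≤²-trans (a≤b , c≤d) (b≤e , d≤f) = ≤-trans a≤b b≤e , ≤-trans c≤d d≤f

≡⇒≤² : ∀ {p q} → p ≡ q → p ≤² q
≡⇒≤² refl = ≤-refl , ≤-refl

+²-mono-≤² : ∀ {p q p′ q′} → p ≤² q → p′ ≤² q′ → (p +² p′) ≤² (q +² q′)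
+²-mono-≤² (a≤b , c≤d) (a′≤b′ , c′≤d′) = +-mono-≤ a≤b a′≤b′ , +-mono-≤ c≤d c′≤d′

degreesIn : ∀ {n} → Digraph n → (Fin n → Bool) → Fin n → ℕ × ℕ
degreesIn D X v = count (λ u → X u ∧ arc D u v) , count (λ u → X u ∧ arc D v u)

Saturated : ∀ {n} → Digraph n → (Fin n → ℕ × ℕ) → (Fin n → Bool) → Set
Saturated D f X = ∀ v → X v ≡ true → f v ≤² degreesIn D X v

induced : ∀ {n} (D : Digraph n) → (Fin n → Bool) → Sub D
induced D X = record { vs = X ; as = λ u v → X u ∧ (X v ∧ arc D u v) ; as⊆ = arcs⊆ }
  where
  arcs⊆ : ∀ u v → X u ∧ (X v ∧ arc D u v) ≡ true → arc D u v ≡ true × X u ≡ true × X v ≡ true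
  arcs⊆ u v e with ∧-elim (X u) e
  ... | Xu , e′ with ∧-elim (X v) e′
  ...   | Xv , uv = uv , Xu , Xv

degreesIn-induced : ∀ {n} (D : Digraph n) X {v} → X v ≡ true →
  (subIndeg (induced D X) v , subOutdeg (induced D X) v) ≡ degreesIn D X v
degreesIn-induced D X Xv rewrite Xv = refl

record Obstruction {n s} (D : Digraph n) (F : Fin s → Fin n → ℕ × ℕ) (α : Fin n → Fin s) : Set where
  field
    colour        : Fin s
    members       : Fin n → Bool
    monochromatic : ∀ v → members v ≡ true → α v ≡ colour
    nonempty      : ∃[ v ] members v ≡ true
    saturated     : Saturated D (F colour) members

≤²⇒¬<⊎< : ∀ {p q} → p ≤² q → ¬ (proj₁ q < proj₁ p ⊎ proj₂ q < proj₂ p)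
≤²⇒¬<⊎< (a≤b , _) (inj₁ b<a) = <⇒≱ b<a a≤b
≤²⇒¬<⊎< (_ , c≤d) (inj₂ d<c) = <⇒≱ d<c c≤d

obstruction⇒¬dicolouring : ∀ {n s} {D : Digraph n} {F : Fin s → Fin n → ℕ × ℕ} {α} →
  Obstruction D F α → ¬ IsFDicolouring D F α
obstruction⇒¬dicolouring {D = D} {F} o dicolouring
  with dicolouring colour (induced D members) monochromatic nonempty
  where open Obstruction o
... | v , Xv , violation = ≤²⇒¬<⊎< demand≤degrees violation
  where
  open Obstruction o
  demand≤degrees : F colour v ≤² (subIndeg (induced D members) v , subOutdeg (induced D members) v)
  demand≤degrees = subst (F colour v ≤²_) (sym (degreesIn-induced D members Xv)) (saturated v Xv)

degreesIn-mono : ∀ {n} (D : Digraph n) {X Y : Fin n → Bool} → (∀ u → X u ≡ true → Y u ≡ true) →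
  ∀ v → degreesIn D X v ≤² degreesIn D Y v
degreesIn-mono D {X} {Y} X⊆Y v = count-mono restrict , count-mono restrict
  where
  restrict : ∀ {adj : Fin _ → Bool} u → X u ∧ adj u ≡ true → Y u ∧ adj u ≡ true
  restrict u e with ∧-elim (X u) e
  ... | Xu , adj-u = ∧-intro (X⊆Y u Xu) adj-u

-- Disjointness away from v suffices: v is never its own neighbour.
degreesIn-∪ : ∀ {n} (D : Digraph n) {X Y : Fin n → Bool} v → (∀ u → X u ≡ true → Y u ≡ true → u ≡ v) →
  (degreesIn D X v +² degreesIn D Y v) ≤² degreesIn D (λ u → X u ∨ Y u) v
degreesIn-∪ D {X} {Y} v X∩Y⊆v =
  split (λ u → arc D u v) (loopless D v) , split (λ u → arc D v u) (loopless D v)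
  where
  regroup : (adj : Fin _ → Bool) →
    count (λ u → X u ∧ adj u ∨ Y u ∧ adj u) ≡ count (λ u → (X u ∨ Y u) ∧ adj u)
  regroup adj = count-cong λ u → sym (Bool.∧-distribʳ-∨ (adj u) (X u) (Y u))
  disjoint : (adj : Fin _ → Bool) → adj v ≡ false → ∀ u → X u ∧ adj u ≡ true → Y u ∧ adj u ≡ true → ⊥
  disjoint adj ¬adj-v u X∧adj Y∧adj with ∧-elim (X u) X∧adj | ∧-elim (Y u) Y∧adj
  ... | Xu , adj-u | Yu , _ with X∩Y⊆v u Xu Yu
  ...   | refl with () ← trans (sym adj-u) ¬adj-v
  split : (adj : Fin _ → Bool) → adj v ≡ false →
    count (λ u → X u ∧ adj u) + count (λ u → Y u ∧ adj u) ≤ count (λ u → (X u ∨ Y u) ∧ adj u)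
  split adj ¬adj-v = ≤-trans (count-∨ (disjoint adj ¬adj-v)) (≤-reflexive (regroup adj))

degreesIn-complete : ∀ {n} (D : Digraph n) → BidirectedComplete D → ∀ X {v} → X v ≡ true →
  (count X , count X) ≤² (suc (proj₁ (degreesIn D X v)) , suc (proj₂ (degreesIn D X v)))
degreesIn-complete D complete X {v} Xv =
  others (λ u u≢v → proj₂ (complete u v) u≢v) , others (λ u u≢v → proj₂ (complete v u) (u≢v ∘ sym))
  where
  others : {adj : Fin _ → Bool} → (∀ u → u ≢ v → adj u ≡ true) →
    count X ≤ suc (count (λ u → X u ∧ adj u))
  others {adj} adjacent = ≤-trans (≤-reflexive (count-remove v Xv)) (s≤s (count-mono other⇒adjacent))
    where
    other⇒adjacent : ∀ u → not (u == v) ∧ X u ≡ true → X u ∧ adj u ≡ true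
    other⇒adjacent u e with ∧-elim (not (u == v)) e
    ... | u≢v , Xu = ∧-intro Xu (adjacent u (not==⇒≢ u≢v))

module _ {A : Set} (_≟ᴬ_ : DecidableEquality A) {a b : A}
         (c : ℕ → A) (two-valued : ∀ t → c t ≡ a ⊎ c t ≡ b) where

  period-two : ∀ t → c t ≢ c (suc t) → c (suc t) ≢ c (suc (suc t)) → c (suc (suc t)) ≡ c t
  period-two t ne₀ ne₁ with two-valued t | two-valued (suc t) | two-valued (suc (suc t))
  ... | inj₁ p | inj₁ q | _      = ⊥-elim (ne₀ (trans p (sym q)))
  ... | inj₂ p | inj₂ q | _      = ⊥-elim (ne₀ (trans p (sym q)))
  ... | _      | inj₁ q | inj₁ r = ⊥-elim (ne₁ (trans q (sym r)))
  ... | _      | inj₂ q | inj₂ r = ⊥-elim (ne₁ (trans q (sym r)))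
  ... | inj₁ p | inj₂ _ | inj₁ r = trans r (sym p)
  ... | inj₂ p | inj₁ _ | inj₂ r = trans r (sym p)

  alternating-even : ∀ k → (∀ t → t < k * 2 → c t ≢ c (suc t)) → c (k * 2) ≡ c 0
  alternating-even zero    _           = refl
  alternating-even (suc k) alternating = trans
    (period-two (k * 2) (alternating (k * 2) (m<n⇒m<1+n ≤-refl)) (alternating (suc (k * 2)) ≤-refl))
    (alternating-even k (λ t t<2k → alternating t (m<n⇒m<1+n (m<n⇒m<1+n t<2k))))

  monochromaticStep : ∀ k → c (suc (k * 2)) ≡ c 0 → ∃[ t ] t < suc (k * 2) × c t ≡ c (suc t)
  monochromaticStep k closed with anyUpTo? (λ t → c t ≟ᴬ c (suc t)) (suc (k * 2))
  ... | yes found = found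
  ... | no  none = k * 2 , ≤-refl , trans (alternating-even k changes) (sym closed)
    where
    changes : ∀ t → t < k * 2 → c t ≢ c (suc t)
    changes t t<2k same = none (t , m<n⇒m<1+n t<2k , same)

toℕ-mod : ∀ t m .{{_ : NonZero m}} → toℕ (t mod m) ≡ t % m
toℕ-mod t m = toℕ-fromℕ< _

toℕ-mod-< : ∀ {t m} .{{_ : NonZero m}} → t < m → toℕ (t mod m) ≡ t
toℕ-mod-< {t} {m} t<m = trans (toℕ-mod t m) (m<n⇒m%n≡m t<m)

cycNext-mod : ∀ m .{{_ : NonZero m}} t → t < m → CycNext (t mod m) (suc t mod m)
cycNext-mod m t t<m with m≤n⇒m<n∨m≡n t<m
... | inj₁ 1+t<m = inj₁ (trans (cong suc (toℕ-mod-< t<m)) (sym (toℕ-mod-< 1+t<m)))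
... | inj₂ 1+t≡m = inj₂ (trans (cong suc (toℕ-mod-< t<m)) 1+t≡m ,
                         trans (toℕ-mod (suc t) m) (trans (cong (_% m) 1+t≡m) (n%n≡0 m)))

module _ {n s} {D : Digraph n} {F : Fin s → Fin n → ℕ × ℕ} {α : Fin n → Fin s} where

  singletonObstruction : ∀ v → F (α v) v ≡ (0 , 0) → Obstruction D F α
  singletonObstruction v Fv≡0 = record
    { colour        = α v
    ; members       = _== v
    ; monochromatic = λ u u∈ → cong α (==⇒≡ {u = u} {v} u∈)
    ; nonempty      = v , ==-refl v
    ; saturated     = saturated }
    where
    saturated : Saturated D (F (α v)) (_== v)
    saturated u u∈ with refl ← ==⇒≡ {u = u} {v} u∈ rewrite Fv≡0 = z≤n , z≤n

  wholeObstruction : 0 < n → ∀ i → (∀ v → α v ≡ i) → (∀ v → F i v ≡ (indeg D v , outdeg D v)) →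
    Obstruction D F α
  wholeObstruction z<s i all-i Fi≡deg = record
    { colour        = i
    ; members       = λ _ → true
    ; monochromatic = λ v _ → all-i v
    ; nonempty      = zero , refl
    ; saturated     = λ v _ → ≡⇒≤² (Fi≡deg v) }

  digonObstruction : ∀ a b → arc D a b ≡ true → arc D b a ≡ true → α a ≡ α b →
    (∀ v → F (α a) v ≤² (1 , 1)) → Obstruction D F α
  digonObstruction a b ab ba αa≡αb F≤1 = record
    { colour        = α a
    ; members       = pair
    ; monochromatic = monochromatic
    ; nonempty      = a , a∈
    ; saturated     = saturated }
    where
    pair : Fin n → Bool
    pair u = (u == a) ∨ (u == b)
    a∈ : pair a ≡ true
    a∈ = cong (_∨ (a == b)) (==-refl a)
    b∈ : pair b ≡ true
    b∈ = ∨-introʳ (b == a) (==-refl b)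
    pair-elim : ∀ u → pair u ≡ true → u ≡ a ⊎ u ≡ b
    pair-elim u u∈ with ∨-elim (u == a) u∈
    ... | inj₁ u≡a = inj₁ (==⇒≡ {u = u} u≡a)
    ... | inj₂ u≡b = inj₂ (==⇒≡ {u = u} u≡b)
    monochromatic : ∀ u → pair u ≡ true → α u ≡ α a
    monochromatic u u∈ with pair-elim u u∈
    ... | inj₁ refl = refl
    ... | inj₂ refl = sym αa≡αb
    saturated : Saturated D (F (α a)) pair
    saturated u u∈ with pair-elim u u∈
    ... | inj₁ refl = ≤²-trans (F≤1 a) (count-pos b (∧-intro b∈ ba) , count-pos b (∧-intro b∈ ab))
    ... | inj₂ refl = ≤²-trans (F≤1 b) (count-pos a (∧-intro a∈ ab) , count-pos a (∧-intro a∈ ba))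

  completeObstruction : BidirectedComplete D → (c : Fin s → ℕ) → (∀ k v → F k v ≡ (c k , c k)) →
    sumFin c < n → Obstruction D F α
  completeObstruction complete c Fk≡c Σc<n with pigeonhole-weighted α c Σc<n
  ... | k , overfull = record
    { colour        = k
    ; members       = class
    ; monochromatic = λ v v∈ → ==⇒≡ {u = α v} v∈
    ; nonempty      = count-witness class (≤-trans (s≤s z≤n) overfull)
    ; saturated     = saturated }
    where
    class : Fin n → Bool
    class v = α v == k
    saturated : Saturated D (F k) class
    saturated v v∈ with degreesIn-complete D complete class v∈
    ... | in-bound , out-bound = subst (_≤² degreesIn D class v) (sym (Fk≡c k v))
      (≤-pred (≤-trans overfull in-bound) , ≤-pred (≤-trans overfull out-bound))

  oddCycleObstruction : BidirectedOddCycle D → ∀ {i j} → (∀ v → α v ≡ i ⊎ α v ≡ j) →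
    (∀ v → F i v ≡ (1 , 1)) → (∀ v → F j v ≡ (1 , 1)) → Obstruction D F α
  -- Walking the cycle through positions t mod n makes its closing arc an ordinary step.
  oddCycleObstruction ((k , refl) , σ , cycle) two-coloured Fi≡1 Fj≡1 =
    digonAt (monochromaticStep _≟_ colourAt (two-coloured ∘ position) (suc k) closed)
    where
    position : ℕ → Fin n
    position t = Bijection.to σ (t mod n)
    colourAt : ℕ → Fin s
    colourAt t = α (position t)
    length≡ : n ≡ suc (suc k * 2)
    length≡ = cong (3 +_) (*-comm 2 k)
    closed : colourAt (suc (suc k * 2)) ≡ colourAt 0
    closed = cong (α ∘ Bijection.to σ) (toℕ-injective (begin
      toℕ (suc (suc k * 2) mod n) ≡⟨ toℕ-mod (suc (suc k * 2)) n ⟩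
      suc (suc k * 2) % n         ≡⟨ cong (_% n) length≡ ⟨
      n % n                       ≡⟨ n%n≡0 n ⟩
      0                           ≡⟨ toℕ-mod-< {m = n} z<s ⟨
      toℕ (0 mod n)               ∎))
      where open ≡-Reasoning
    demand≤1 : ∀ u v → F (α u) v ≤² (1 , 1)
    demand≤1 u v with two-coloured u
    ... | inj₁ coloured-i rewrite coloured-i = ≡⇒≤² (Fi≡1 v)
    ... | inj₂ coloured-j rewrite coloured-j = ≡⇒≤² (Fj≡1 v)
    digonAt : ∃[ t ] t < suc (suc k * 2) × colourAt t ≡ colourAt (suc t) → Obstruction D F α
    digonAt (t , t<1+N , same) =
      digonObstruction (position t) (position (suc t)) forward backward same (demand≤1 (position t))
      where
      adjacent : CycNext (t mod n) (suc t mod n)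
      adjacent = cycNext-mod n t (subst (t <_) (sym length≡) t<1+N)
      forward : arc D (position t) (position (suc t)) ≡ true
      forward = proj₂ (cycle (t mod n) (suc t mod n)) (inj₁ adjacent)
      backward : arc D (position (suc t)) (position t) ≡ true
      backward = proj₂ (cycle (suc t mod n) (t mod n)) (inj₂ adjacent)

image : ∀ {m n} → (Fin m → Fin n) → (Fin m → Bool) → Fin n → Bool
image ι X u = does (any? λ a → (ι a ≟ u) ×-dec (X a Bool.≟ true))

image-intro : ∀ {m n} (ι : Fin m → Fin n) {X} {a} → X a ≡ true → image ι X (ι a) ≡ true
image-intro ι {X} {a} Xa = dec-true (any? λ b → (ι b ≟ ι a) ×-dec (X b Bool.≟ true)) (a , refl , Xa)

image-elim : ∀ {m n} (ι : Fin m → Fin n) X {u} → image ι X u ≡ true → ∃[ a ] ι a ≡ u × X a ≡ true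
image-elim ι X {u} u∈ with any? (λ a → (ι a ≟ u) ×-dec (X a Bool.≟ true))
... | yes found = found

module _ {m n} (D′ : Digraph m) (D : Digraph n) {ι : Fin m → Fin n}
         (ι-injective : Injective _≡_ _≡_ ι) (arc-ι : ∀ a b → arc D (ι a) (ι b) ≡ arc D′ a b) where

  degreesIn-image : ∀ X a → degreesIn D′ X a ≤² degreesIn D (image ι X) (ι a)
  degreesIn-image X a = count-inj ι-injective (transport (λ u → arc D u (ι a)) (λ b → arc-ι b a)) ,
                        count-inj ι-injective (transport (λ u → arc D (ι a) u) (λ b → arc-ι a b))
    where
    transport : ∀ {adj′ : Fin m → Bool} (adj : Fin n → Bool) → (∀ b → adj (ι b) ≡ adj′ b) →
      ∀ b → X b ∧ adj′ b ≡ true → image ι X (ι b) ∧ adj (ι b) ≡ true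
    transport _ adj≡adj′ b e with ∧-elim (X b) e
    ... | Xb , adj′-b = ∧-intro (image-intro ι Xb) (trans (adj≡adj′ b) adj′-b)

  pushObstruction : ∀ {s} {F′ : Fin s → Fin m → ℕ × ℕ} {F : Fin s → Fin n → ℕ × ℕ} {α} x →
    (∀ k a → a ≢ x → F k (ι a) ≡ F′ k a) →
    (o : Obstruction D′ F′ (α ∘ ι)) → Obstruction.members o x ≡ false → Obstruction D F α
  pushObstruction {F′ = F′} {F} {α} x F≡F′ o x∉ = record
    { colour        = colour
    ; members       = image ι members
    ; monochromatic = monochromatic′
    ; nonempty      = ι (proj₁ nonempty) , image-intro ι (proj₂ nonempty)
    ; saturated     = saturated′ }
    where
    open Obstruction o
    monochromatic′ : ∀ u → image ι members u ≡ true → α u ≡ colour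
    monochromatic′ u u∈ with image-elim ι members u∈
    ... | a , refl , a∈ = monochromatic a a∈
    saturated′ : Saturated D (F colour) (image ι members)
    saturated′ u u∈ with image-elim ι members u∈
    ... | a , refl , a∈ = ≤²-trans (≡⇒≤² (F≡F′ colour a a≢x))
                            (≤²-trans (saturated a a∈) (degreesIn-image members a))
      where
      a≢x : a ≢ x
      a≢x refl with () ← trans (sym a∈) x∉

module _ {n n₁ n₂} {D : Digraph n} {D₁ : Digraph n₁} {D₂ : Digraph n₂}
         {ι₁ : Fin n₁ → Fin n} {ι₂ : Fin n₂ → Fin n} {x₁ : Fin n₁} {x₂ : Fin n₂}
         (ι₁-injective : Injective _≡_ _≡_ ι₁) (ι₂-injective : Injective _≡_ _≡_ ι₂)
         (ι₁x₁≡ι₂x₂ : ι₁ x₁ ≡ ι₂ x₂) (meet : ∀ a b → ι₁ a ≡ ι₂ b → a ≡ x₁)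
         (arc-ι₁ : ∀ a b → arc D (ι₁ a) (ι₁ b) ≡ arc D₁ a b)
         (arc-ι₂ : ∀ a b → arc D (ι₂ a) (ι₂ b) ≡ arc D₂ a b) where

  images-meet : ∀ X₁ X₂ u → image ι₁ X₁ u ≡ true → image ι₂ X₂ u ≡ true → u ≡ ι₁ x₁
  images-meet X₁ X₂ u u∈₁ u∈₂ with image-elim ι₁ X₁ u∈₁ | image-elim ι₂ X₂ u∈₂
  ... | a , refl , _ | b , ι₂b≡ι₁a , _ = cong ι₁ (meet a b (sym ι₂b≡ι₁a))

  glueObstruction : ∀ {s} {F : Fin s → Fin n → ℕ × ℕ} {F₁ F₂} {α} →
    (∀ k a → a ≢ x₁ → F k (ι₁ a) ≡ F₁ k a) → (∀ k b → b ≢ x₂ → F k (ι₂ b) ≡ F₂ k b) →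
    (∀ k → F k (ι₁ x₁) ≡ F₁ k x₁ +² F₂ k x₂) →
    (o₁ : Obstruction D₁ F₁ (α ∘ ι₁)) (o₂ : Obstruction D₂ F₂ (α ∘ ι₂)) →
    Obstruction.members o₁ x₁ ≡ true → Obstruction.members o₂ x₂ ≡ true → Obstruction D F α
  glueObstruction {F = F} {F₁} {F₂} {α} F≡F₁ F≡F₂ F-x
    record { colour = c ; members = X₁ ; monochromatic = mono₁ ; saturated = sat₁ }
    record { colour = _ ; members = X₂ ; monochromatic = mono₂ ; saturated = sat₂ } x₁∈ x₂∈
    with trans (sym (mono₂ x₂ x₂∈)) (trans (cong α (sym ι₁x₁≡ι₂x₂)) (mono₁ x₁ x₁∈))
  ... | refl = record
    { colour        = c
    ; members       = union
    ; monochromatic = monochromatic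
    ; nonempty      = ι₁ x₁ , left (ι₁ x₁) (image-intro ι₁ x₁∈)
    ; saturated     = saturated }
    where
    union : Fin n → Bool
    union u = image ι₁ X₁ u ∨ image ι₂ X₂ u
    left : ∀ u → image ι₁ X₁ u ≡ true → union u ≡ true
    left u u∈₁ = cong (_∨ image ι₂ X₂ u) u∈₁
    right : ∀ u → image ι₂ X₂ u ≡ true → union u ≡ true
    right u = ∨-introʳ (image ι₁ X₁ u)
    monochromatic : ∀ u → union u ≡ true → α u ≡ c
    monochromatic u u∈ with ∨-elim (image ι₁ X₁ u) u∈
    ... | inj₁ u∈₁ with image-elim ι₁ X₁ u∈₁
    ...   | a , refl , a∈ = mono₁ a a∈
    monochromatic u u∈ | inj₂ u∈₂ with image-elim ι₂ X₂ u∈₂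
    ...   | b , refl , b∈ = mono₂ b b∈
    lifted₁ : ∀ a → X₁ a ≡ true → F₁ c a ≤² degreesIn D (image ι₁ X₁) (ι₁ a)
    lifted₁ a a∈ = ≤²-trans (sat₁ a a∈) (degreesIn-image D₁ D ι₁-injective arc-ι₁ X₁ a)
    lifted₂ : ∀ b → X₂ b ≡ true → F₂ c b ≤² degreesIn D (image ι₂ X₂) (ι₂ b)
    lifted₂ b b∈ = ≤²-trans (sat₂ b b∈) (degreesIn-image D₂ D ι₂-injective arc-ι₂ X₂ b)
    at-x : F c (ι₁ x₁) ≤² degreesIn D union (ι₁ x₁)
    at-x = ≤²-trans (≡⇒≤² (F-x c))
      (≤²-trans (+²-mono-≤² (lifted₁ x₁ x₁∈) (subst (λ y → F₂ c x₂ ≤² degreesIn D (image ι₂ X₂) y)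
                                                      (sym ι₁x₁≡ι₂x₂) (lifted₂ x₂ x₂∈)))
                (degreesIn-∪ D (ι₁ x₁) (images-meet X₁ X₂)))
    saturated : Saturated D (F c) union
    saturated u u∈ with ∨-elim (image ι₁ X₁ u) u∈
    ... | inj₁ u∈₁ with image-elim ι₁ X₁ u∈₁
    ...   | a , refl , a∈ with a ≟ x₁
    ...     | yes refl = at-x
    ...     | no  a≢x₁ = ≤²-trans (≡⇒≤² (F≡F₁ c a a≢x₁))
                           (≤²-trans (lifted₁ a a∈) (degreesIn-mono D left (ι₁ a)))
    saturated u u∈ | inj₂ u∈₂ with image-elim ι₂ X₂ u∈₂
    ...   | b , refl , b∈ with b ≟ x₂
    ...     | yes refl = subst (λ y → F c y ≤² degreesIn D union y) ι₁x₁≡ι₂x₂ at-x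
    ...     | no  b≢x₂ = ≤²-trans (≡⇒≤² (F≡F₂ c b b≢x₂))
                           (≤²-trans (lifted₂ b b∈) (degreesIn-mono D right (ι₂ b)))

obstruction : ∀ {n s} {D : Digraph n} {F : Fin s → Fin n → ℕ × ℕ} → Hard D F → ∀ α → Obstruction D F α
-- Of biconnectivity, case (i) only needs D to be non-empty.
obstruction (hard-i _ _ (2≤n , _) i Fi≡deg F≡0) α with any? (λ v → ¬? (α v ≟ i))
... | yes (v , αv≢i) = singletonObstruction v (F≡0 (α v) v αv≢i)
... | no  none       = wholeObstruction (≤-trans (s≤s z≤n) 2≤n) i coloured-i Fi≡deg
  where
  coloured-i : ∀ v → α v ≡ i
  coloured-i v = decidable-stable (α v ≟ i) (λ αv≢i → none (v , αv≢i))
obstruction (hard-ii _ _ oddCycle i j _ Fi≡1 Fj≡1 F≡0) α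
  with any? (λ v → ¬? (α v ≟ i) ×-dec ¬? (α v ≟ j))
... | yes (v , αv≢i , αv≢j) = singletonObstruction v (F≡0 (α v) v αv≢i αv≢j)
... | no  none              = oddCycleObstruction oddCycle two-coloured Fi≡1 Fj≡1
  where
  two-coloured : ∀ v → α v ≡ i ⊎ α v ≡ j
  two-coloured v with α v ≟ i | α v ≟ j
  ... | yes αv≡i | _        = inj₁ αv≡i
  ... | no  _    | yes αv≡j = inj₂ αv≡j
  ... | no  αv≢i | no αv≢j  = ⊥-elim (none (v , αv≢i , αv≢j))
obstruction (hard-iii _ _ complete c F≡c 1+Σc≡n) α =
  completeObstruction complete c F≡c (≤-reflexive 1+Σc≡n)
-- Obstructions live inside the images of D₁ and D₂, and extra arcs only raise degrees.
obstruction (hard-iv D _ D₁ _ D₂ _ hard₁ hard₂ ι₁ ι₂ x₁ x₂ ι₁-injective ι₂-injective ι₁x₁≡ι₂x₂ meet _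
                     arc-ι₁ arc-ι₂ _ F≡F₁ F≡F₂ F-x) α
  with obstruction hard₁ (α ∘ ι₁) | obstruction hard₂ (α ∘ ι₂)
... | o₁ | o₂ with Obstruction.members o₁ x₁ in x₁∈ | Obstruction.members o₂ x₂ in x₂∈
...   | false | _     = pushObstruction D₁ D ι₁-injective arc-ι₁ x₁ F≡F₁ o₁ x₁∈
...   | true  | false = pushObstruction D₂ D ι₂-injective arc-ι₂ x₂ F≡F₂ o₂ x₂∈
...   | true  | true  =
  glueObstruction ι₁-injective ι₂-injective ι₁x₁≡ι₂x₂ meet arc-ι₁ arc-ι₂ F≡F₁ F≡F₂ F-x o₁ o₂ x₁∈ x₂∈

lemma9 : ∀ {n s} (D : Digraph n) (F : Fin s → Fin n → ℕ × ℕ) →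
    Hard D F → ¬ FDicolourable D F
lemma9 D F hard (α , dicolouring) = obstruction⇒¬dicolouring (obstruction hard α) dicolouring
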